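{- For $n\ge1$ and $a,b\in\mathbb{N}\cup\{0\}$, \[ \sum_{k=0}^{bn}\binom{bn}{k}E_{n-1}^{(bn)}(x+k)=2^{bn}(n-1)!\sum_{l=0}^{n-1}\frac{(an)!}{(l+an)!\,(n-1-l)!}S_2(l+an,an)\,B_{n-1-l}^{(an)}(x). \]
   Context: For real $r$, the Bernoulli polynomials of order $r$ are defined by $\left(\frac{t}{e^t-1}\right)^re^{xt}=\sum_{n\ge0}B_n^{(r)}(x)\frac{t^n}{n!}$, and the Euler polynomials of order $r$ by $\left(\frac{2}{e^t+1}\right)^re^{xt}=\sum_{n\ge0}E_n^{(r)}(x)\frac{t^n}{n!}$. $S_2(n,k)$ denotes the Stirling numbers of the second kind.
   Formalization: The variable x at which the Euler and Bernoulli polynomials are evaluated ranges over the rationals. -}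

module Defs where

open import Data.Nat as ℕ using (ℕ; zero; suc)
open import Data.Nat.Combinatorics using (_C_)
open import Data.Nat.Base using (_!)
open import Data.Integer using (+_)
open import Data.Rational using (ℚ; 0ℚ; 1ℚ; _+_; _*_; -_; _/_)
open import Data.List using (List; []; _∷_; map; zipWith; foldr; upTo)

sumTo : ℕ → (ℕ → ℚ) → ℚ
sumTo zero    f = f 0
sumTo (suc n) f = sumTo n f + f (suc n)

ℕ→ℚ : ℕ → ℚ
ℕ→ℚ n = + n / 1

recipℕ : ℕ → ℚ
recipℕ zero    = 0ℚ
recipℕ (suc d) = + 1 / suc d

_^ℚ_ : ℚ → ℕ → ℚ
x ^ℚ zero  = 1ℚ
x ^ℚ suc k = x * (x ^ℚ k)

S₂ : ℕ → ℕ → ℕ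
S₂ zero    zero    = 1
S₂ zero    (suc k) = 0
S₂ (suc n) zero    = 0
S₂ (suc n) (suc k) = suc k ℕ.* S₂ n (suc k) ℕ.+ S₂ n k

PS : Set
PS = ℕ → ℚ

_⋆_ : PS → PS → PS
(f ⋆ g) n = sumTo n (λ k → f k * g (n ℕ.∸ k))

oneS : PS
oneS zero    = 1ℚ
oneS (suc _) = 0ℚ

_^S_ : PS → ℕ → PS
f ^S zero  = oneS
f ^S suc r = f ⋆ (f ^S r)

-- multiplicative inverse of a power series with constant term 1:
-- g 0 = 1,  g (n+1) = - Σ_{k=0}^{n} f (k+1) g (n-k).
-- invRev f n = [g n, g (n-1), ..., g 0]
invRev : PS → ℕ → List ℚ
invRev f zero    = 1ℚ ∷ []
invRev f (suc n) =
  let gs = invRev f n in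
  (- foldr _+_ 0ℚ (zipWith _*_ (map (λ k → f (suc k)) (upTo (suc n))) gs)) ∷ gs

invS : PS → PS
invS f n with invRev f n
... | []    = 0ℚ
... | g ∷ _ = g

expS : ℚ → PS
expS x k = (x ^ℚ k) * recipℕ (k !)

expm1OverT : PS
expm1OverT k = recipℕ (suc k !)

expp1Over2 : PS
expp1Over2 zero    = 1ℚ
expp1Over2 (suc k) = recipℕ (2 ℕ.* (suc k !))

-- Bernoulli polynomials of order r:  (t/(e^t-1))^r e^{xt} = Σ B_n^{(r)}(x) t^n/n!
Bpoly : ℕ → ℕ → ℚ → ℚ
Bpoly r n x = ℕ→ℚ (n !) * ((invS expm1OverT ^S r) ⋆ expS x) n

-- Euler polynomials of order r:  (2/(e^t+1))^r e^{xt} = Σ E_n^{(r)}(x) t^n/n!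
Epoly : ℕ → ℕ → ℚ → ℚ
Epoly r n x = ℕ→ℚ (n !) * ((invS expp1Over2 ^S r) ⋆ expS x) n

module Submission where

-- Both sides of the identity equal  2^N · x^m  (N = b·n, A = a·n, n = m + 1).
-- We work in the ring ℚ[[t]] of formal power series, represented by coefficient
-- sequences, with  P = (e^t + 1)/2,  G = P⁻¹,  F = (e^t − 1)/t,  H = F⁻¹.
--
-- * Left side.  Since 1 + e^t = 2P, the binomial theorem together with
--   e^{yt} e^{kt} = e^{(y+k)t} gives  Σ_k C(N,k) e^{(x+k)t} = 2^N P^N e^{xt}.
--   Hence  Σ_k C(N,k) E_m^{(N)}(x+k) = m! [t^m] G^N · 2^N P^N e^{xt} = 2^N m! [t^m] e^{xt}.
-- * Right side.  The exponential generating function of the Stirling numbers,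
--   Σ_l A! S₂(l+A, A)/(l+A)! t^l = F^A, turns the inner sum into the convolution
--   [t^m] F^A · H^A e^{xt} = [t^m] e^{xt}.

open import Defs
open import Data.Nat as ℕ using (ℕ; zero; suc; _!; _∸_; NonZero)
open import Data.Nat.Combinatorics using (_C_; nCk+nC[k+1]≡[n+1]C[k+1])
open import Data.Nat.Combinatorics.Specification using (k>n⇒nCk≡0)
import Data.Nat.Properties as ℕP
import Data.Integer as ℤ
import Data.Integer.Properties as ℤP
open import Data.Nat.Coprimality using (1-coprimeTo) renaming (sym to coprime-sym)
open import Data.Rational using (ℚ; mkℚ; 0ℚ; 1ℚ; _+_; _*_; -_; toℚᵘ)
open import Data.Rational.Properties
import Data.Rational.Unnormalised as U
import Data.Rational.Unnormalised.Properties as UP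
open import Data.Rational.Solver using (module +-*-Solver)
open import Data.List using (_∷_; map; zipWith; foldr; upTo; applyUpTo)
open import Relation.Binary.PropositionalEquality
open import Relation.Binary.Bundles using (Setoid)
import Relation.Binary.Reasoning.Setoid as SetoidReasoning
open +-*-Solver

-- ℕ→ℚ n is already in normal form, which lets us compute in ℚᵘ.
ℕ→ℚ-normal : ∀ n → ℕ→ℚ n ≡ mkℚ (ℤ.+ n) 0 (coprime-sym (1-coprimeTo n))
ℕ→ℚ-normal n = normalize-coprime (coprime-sym (1-coprimeTo n))

toℚᵘ-ℕ→ℚ : ∀ n → toℚᵘ (ℕ→ℚ n) ≡ U.mkℚᵘ (ℤ.+ n) 0
toℚᵘ-ℕ→ℚ n = cong toℚᵘ (ℕ→ℚ-normal n)

ℕ→ℚ-+ : ∀ a b → ℕ→ℚ (a ℕ.+ b) ≡ ℕ→ℚ a + ℕ→ℚ b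
ℕ→ℚ-+ a b = toℚᵘ-injective (UP.≃-trans (UP.≃-reflexive lhs) (UP.≃-sym (toℚᵘ-homo-+ (ℕ→ℚ a) (ℕ→ℚ b))))
  where
  lhs : toℚᵘ (ℕ→ℚ (a ℕ.+ b)) ≡ toℚᵘ (ℕ→ℚ a) U.+ toℚᵘ (ℕ→ℚ b)
  lhs = trans (toℚᵘ-ℕ→ℚ (a ℕ.+ b))
     (trans (cong₂ (λ x y → U.mkℚᵘ (x ℤ.+ y) 0) (sym (ℤP.*-identityʳ (ℤ.+ a))) (sym (ℤP.*-identityʳ (ℤ.+ b))))
            (sym (cong₂ U._+_ (toℚᵘ-ℕ→ℚ a) (toℚᵘ-ℕ→ℚ b))))

ℕ→ℚ-* : ∀ a b → ℕ→ℚ (a ℕ.* b) ≡ ℕ→ℚ a * ℕ→ℚ b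
ℕ→ℚ-* a b = toℚᵘ-injective (UP.≃-trans (UP.≃-reflexive lhs) (UP.≃-sym (toℚᵘ-homo-* (ℕ→ℚ a) (ℕ→ℚ b))))
  where
  lhs : toℚᵘ (ℕ→ℚ (a ℕ.* b)) ≡ toℚᵘ (ℕ→ℚ a) U.* toℚᵘ (ℕ→ℚ b)
  lhs = trans (toℚᵘ-ℕ→ℚ (a ℕ.* b))
     (trans (cong (λ z → U.mkℚᵘ z 0) (ℤP.pos-* a b)) (sym (cong₂ U._*_ (toℚᵘ-ℕ→ℚ a) (toℚᵘ-ℕ→ℚ b))))

ℕ→ℚ-^ : ∀ a k → ℕ→ℚ (a ℕ.^ k) ≡ ℕ→ℚ a ^ℚ k
ℕ→ℚ-^ a zero    = refl
ℕ→ℚ-^ a (suc k) = trans (ℕ→ℚ-* a (a ℕ.^ k)) (cong (ℕ→ℚ a *_) (ℕ→ℚ-^ a k))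

1^ℚ : ∀ k → 1ℚ ^ℚ k ≡ 1ℚ
1^ℚ zero    = refl
1^ℚ (suc k) = trans (*-identityˡ _) (1^ℚ k)

recipℕ-inverse : ∀ n .{{_ : NonZero n}} → recipℕ n * ℕ→ℚ n ≡ 1ℚ
recipℕ-inverse (suc d) =
  trans (cong₂ _*_ (normalize-coprime (1-coprimeTo (suc d))) (ℕ→ℚ-normal (suc d)))
        (*-inverseˡ (mkℚ (ℤ.+ suc d) 0 (coprime-sym (1-coprimeTo (suc d)))))

recipℕ-!-inverse : ∀ n → recipℕ (n !) * ℕ→ℚ (n !) ≡ 1ℚ
recipℕ-!-inverse n = recipℕ-inverse (n !) {{n ℕP.!≢0}}

inverse-unique : ∀ {p r q} → p * q ≡ 1ℚ → r * q ≡ 1ℚ → p ≡ r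
inverse-unique {p} {r} {q} pq rq = begin
  p            ≡⟨ sym (*-identityʳ p) ⟩
  p * 1ℚ       ≡⟨ cong (p *_) (sym rq) ⟩
  p * (r * q)  ≡⟨ solve 3 (λ p r q → p :* (r :* q) := (p :* q) :* r) refl p r q ⟩
  (p * q) * r  ≡⟨ cong (_* r) pq ⟩
  1ℚ * r       ≡⟨ *-identityˡ r ⟩
  r            ∎
  where open ≡-Reasoning

recipℕ-* : ∀ a b → recipℕ (a ℕ.* b) ≡ recipℕ a * recipℕ b
recipℕ-* zero    b       = sym (*-zeroˡ (recipℕ b))
recipℕ-* (suc a) zero    = trans (cong recipℕ (ℕP.*-zeroʳ a)) (sym (*-zeroʳ (recipℕ (suc a))))
recipℕ-* (suc a) (suc b) = inverse-unique (recipℕ-inverse (suc a ℕ.* suc b)) (begin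
  recipℕ (suc a) * recipℕ (suc b) * ℕ→ℚ (suc a ℕ.* suc b)
    ≡⟨ cong (recipℕ (suc a) * recipℕ (suc b) *_) (ℕ→ℚ-* (suc a) (suc b)) ⟩
  recipℕ (suc a) * recipℕ (suc b) * (ℕ→ℚ (suc a) * ℕ→ℚ (suc b))
    ≡⟨ solve 4 (λ p q r s → p :* q :* (r :* s) := (p :* r) :* (q :* s)) refl
         (recipℕ (suc a)) (recipℕ (suc b)) (ℕ→ℚ (suc a)) (ℕ→ℚ (suc b)) ⟩
  (recipℕ (suc a) * ℕ→ℚ (suc a)) * (recipℕ (suc b) * ℕ→ℚ (suc b))
    ≡⟨ cong₂ _*_ (recipℕ-inverse (suc a)) (recipℕ-inverse (suc b)) ⟩
  1ℚ ∎)
  where open ≡-Reasoning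

-- (n+1) / (n+1)! = 1 / n!, the step behind every "differentiate e^{xt}" computation.
recipℕ-!-step : ∀ n → ℕ→ℚ (suc n) * recipℕ (suc n !) ≡ recipℕ (n !)
recipℕ-!-step n = begin
  ℕ→ℚ (suc n) * recipℕ (suc n ℕ.* n !)           ≡⟨ cong (ℕ→ℚ (suc n) *_) (recipℕ-* (suc n) (n !)) ⟩
  ℕ→ℚ (suc n) * (recipℕ (suc n) * recipℕ (n !))
    ≡⟨ solve 3 (λ a b c → a :* (b :* c) := (b :* a) :* c) refl (ℕ→ℚ (suc n)) (recipℕ (suc n)) (recipℕ (n !)) ⟩
  (recipℕ (suc n) * ℕ→ℚ (suc n)) * recipℕ (n !)  ≡⟨ cong (_* recipℕ (n !)) (recipℕ-inverse (suc n)) ⟩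
  1ℚ * recipℕ (n !)                              ≡⟨ *-identityˡ _ ⟩
  recipℕ (n !)                                   ∎
  where open ≡-Reasoning

ℕ→ℚ-cancelˡ : ∀ d {u v} → ℕ→ℚ (suc d) * u ≡ ℕ→ℚ (suc d) * v → u ≡ v
ℕ→ℚ-cancelˡ d {u} {v} eq = begin
  u                             ≡⟨ sym (*-identityˡ u) ⟩
  1ℚ * u                        ≡⟨ cong (_* u) (sym (recipℕ-inverse (suc d))) ⟩
  recipℕ (suc d) * ℕ→ℚ (suc d) * u   ≡⟨ *-assoc (recipℕ (suc d)) (ℕ→ℚ (suc d)) u ⟩
  recipℕ (suc d) * (ℕ→ℚ (suc d) * u) ≡⟨ cong (recipℕ (suc d) *_) eq ⟩
  recipℕ (suc d) * (ℕ→ℚ (suc d) * v) ≡⟨ sym (*-assoc (recipℕ (suc d)) (ℕ→ℚ (suc d)) v) ⟩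
  recipℕ (suc d) * ℕ→ℚ (suc d) * v   ≡⟨ cong (_* v) (recipℕ-inverse (suc d)) ⟩
  1ℚ * v                        ≡⟨ *-identityˡ v ⟩
  v                             ∎
  where open ≡-Reasoning

sumTo-cong-≤ : ∀ n {f g : ℕ → ℚ} → (∀ k → k ℕ.≤ n → f k ≡ g k) → sumTo n f ≡ sumTo n g
sumTo-cong-≤ zero    h = h 0 ℕ.z≤n
sumTo-cong-≤ (suc n) h = cong₂ _+_ (sumTo-cong-≤ n (λ k k≤n → h k (ℕP.m≤n⇒m≤1+n k≤n))) (h (suc n) ℕP.≤-refl)

sumTo-cong : ∀ n {f g : ℕ → ℚ} → (∀ k → f k ≡ g k) → sumTo n f ≡ sumTo n g
sumTo-cong n h = sumTo-cong-≤ n (λ k _ → h k)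

sumTo-suc : ∀ n f → sumTo (suc n) f ≡ f 0 + sumTo n (λ k → f (suc k))
sumTo-suc zero    f = refl
sumTo-suc (suc n) f = trans (cong (_+ f (suc (suc n))) (sumTo-suc n f)) (+-assoc (f 0) _ _)

sumTo-+ : ∀ n f g → sumTo n (λ k → f k + g k) ≡ sumTo n f + sumTo n g
sumTo-+ zero    f g = refl
sumTo-+ (suc n) f g = trans (cong (_+ (f (suc n) + g (suc n))) (sumTo-+ n f g))
  (solve 4 (λ a b c d → (a :+ b) :+ (c :+ d) := (a :+ c) :+ (b :+ d)) refl
     (sumTo n f) (sumTo n g) (f (suc n)) (g (suc n)))

sumTo-*ˡ : ∀ n c f → sumTo n (λ k → c * f k) ≡ c * sumTo n f
sumTo-*ˡ zero    c f = refl
sumTo-*ˡ (suc n) c f = trans (cong (_+ c * f (suc n)) (sumTo-*ˡ n c f)) (sym (*-distribˡ-+ c _ _))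

sumTo-*ʳ : ∀ n c f → sumTo n (λ k → f k * c) ≡ sumTo n f * c
sumTo-*ʳ n c f = trans (sumTo-cong n (λ k → *-comm (f k) c)) (trans (sumTo-*ˡ n c f) (*-comm c _))

sumTo-zero : ∀ n → sumTo n (λ _ → 0ℚ) ≡ 0ℚ
sumTo-zero zero    = refl
sumTo-zero (suc n) = trans (+-identityʳ _) (sumTo-zero n)

sumTo-reverse : ∀ n f → sumTo n f ≡ sumTo n (λ k → f (n ∸ k))
sumTo-reverse zero    f = refl
sumTo-reverse (suc n) f = begin
  sumTo (suc n) f                          ≡⟨ sumTo-suc n f ⟩
  f 0 + sumTo n (λ k → f (suc k))          ≡⟨ cong (f 0 +_) (sumTo-reverse n (λ k → f (suc k))) ⟩
  f 0 + sumTo n (λ k → f (suc (n ∸ k)))    ≡⟨ +-comm (f 0) _ ⟩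
  sumTo n (λ k → f (suc (n ∸ k))) + f 0
    ≡⟨ cong₂ _+_ (sumTo-cong-≤ n (λ k k≤n → cong f (sym (ℕP.+-∸-assoc 1 k≤n))))
                 (cong f (sym (ℕP.n∸n≡0 n))) ⟩
  sumTo (suc n) (λ k → f (suc n ∸ k))      ∎
  where open ≡-Reasoning

sumTo-swap : ∀ n M (h : ℕ → ℕ → ℚ) →
  sumTo n (λ i → sumTo M (h i)) ≡ sumTo M (λ k → sumTo n (λ i → h i k))
sumTo-swap zero    M h = refl
sumTo-swap (suc n) M h = trans (cong (_+ sumTo M (h (suc n))) (sumTo-swap n M h))
  (sym (sumTo-+ M (λ k → sumTo n (λ i → h i k)) (h (suc n))))

sumTo-triangle : ∀ n (h : ℕ → ℕ → ℚ) →
  sumTo n (λ k → sumTo k (λ j → h j k)) ≡ sumTo n (λ j → sumTo (n ∸ j) (λ i → h j (j ℕ.+ i)))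
sumTo-triangle zero    h = refl
sumTo-triangle (suc n) h = begin
  sumTo n (λ k → sumTo k (λ j → h j k)) + sumTo (suc n) (λ j → h j (suc n))
    ≡⟨ cong (_+ sumTo (suc n) (λ j → h j (suc n))) (sumTo-triangle n h) ⟩
  Rows + (sumTo n (λ j → h j (suc n)) + h (suc n) (suc n))
    ≡⟨ sym (+-assoc Rows _ _) ⟩
  (Rows + sumTo n (λ j → h j (suc n))) + h (suc n) (suc n)
    ≡⟨ cong₂ _+_ (sym (sumTo-+ n _ _)) corner ⟩
  sumTo n (λ j → sumTo (n ∸ j) (λ i → h j (j ℕ.+ i)) + h j (suc n))
    + sumTo (n ∸ n) (λ i → h (suc n) (suc n ℕ.+ i))
    ≡⟨ cong (_+ sumTo (n ∸ n) (λ i → h (suc n) (suc n ℕ.+ i))) (sumTo-cong-≤ n extend-row) ⟩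
  sumTo (suc n) (λ j → sumTo (suc n ∸ j) (λ i → h j (j ℕ.+ i))) ∎
  where
  open ≡-Reasoning
  Rows = sumTo n (λ j → sumTo (n ∸ j) (λ i → h j (j ℕ.+ i)))
  corner : h (suc n) (suc n) ≡ sumTo (n ∸ n) (λ i → h (suc n) (suc n ℕ.+ i))
  corner rewrite ℕP.n∸n≡0 n | ℕP.+-identityʳ n = refl
  -- each row j ≤ n gains the entry in column n+1
  extend-row : ∀ j → j ℕ.≤ n →
    sumTo (n ∸ j) (λ i → h j (j ℕ.+ i)) + h j (suc n) ≡ sumTo (suc n ∸ j) (λ i → h j (j ℕ.+ i))
  extend-row j j≤n rewrite ℕP.+-∸-assoc 1 j≤n =
    cong (λ z → sumTo (n ∸ j) (λ i → h j (j ℕ.+ i)) + h j z)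
         (sym (trans (ℕP.+-suc j (n ∸ j)) (cong suc (ℕP.m+[n∸m]≡n j≤n))))

-- The algebra of formal power series ℚ[[t]]

-- Coefficientwise equality (function extensionality is not available).
infix 4 _≈_
_≈_ : PS → PS → Set
f ≈ g = ∀ n → f n ≡ g n

≈-refl : ∀ {f} → f ≈ f
≈-refl _ = refl

≈-sym : ∀ {f g} → f ≈ g → g ≈ f
≈-sym p n = sym (p n)

≈-trans : ∀ {f g h} → f ≈ g → g ≈ h → f ≈ h
≈-trans p q n = trans (p n) (q n)

PS-setoid : Setoid _ _
PS-setoid = record
  { Carrier = PS ; _≈_ = _≈_
  ; isEquivalence = record { refl = λ {f} → ≈-refl {f} ; sym = λ {f} {g} → ≈-sym {f} {g}
                           ; trans = λ {f} {g} {h} → ≈-trans {f} {g} {h} } }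

module ≈-Reasoning = SetoidReasoning PS-setoid

infixl 6 _⊕_
infixr 7 _·_
_⊕_ : PS → PS → PS
(f ⊕ g) n = f n + g n

_·_ : ℚ → PS → PS
(c · f) n = c * f n

⋆-cong : ∀ {f f′ g g′} → f ≈ f′ → g ≈ g′ → f ⋆ g ≈ f′ ⋆ g′
⋆-cong p q n = sumTo-cong n (λ k → cong₂ _*_ (p k) (q (n ∸ k)))

⋆-congˡ : ∀ {f f′} g → f ≈ f′ → f ⋆ g ≈ f′ ⋆ g
⋆-congˡ g p = ⋆-cong p (≈-refl {g})

⋆-congʳ : ∀ f {g g′} → g ≈ g′ → f ⋆ g ≈ f ⋆ g′
⋆-congʳ f q = ⋆-cong (≈-refl {f}) q

⊕-cong : ∀ {f f′ g g′} → f ≈ f′ → g ≈ g′ → f ⊕ g ≈ f′ ⊕ g′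
⊕-cong p q n = cong₂ _+_ (p n) (q n)

·-cong : ∀ c {f g} → f ≈ g → c · f ≈ c · g
·-cong c p n = cong (c *_) (p n)

⋆-comm : ∀ f g → f ⋆ g ≈ g ⋆ f
⋆-comm f g n = begin
  sumTo n (λ k → f k * g (n ∸ k))               ≡⟨ sumTo-reverse n _ ⟩
  sumTo n (λ k → f (n ∸ k) * g (n ∸ (n ∸ k)))
    ≡⟨ sumTo-cong-≤ n (λ k k≤n → trans (cong (λ z → f (n ∸ k) * g z) (ℕP.m∸[m∸n]≡n k≤n))
                                        (*-comm (f (n ∸ k)) (g k))) ⟩
  sumTo n (λ k → g k * f (n ∸ k))               ∎
  where open ≡-Reasoning

⋆-assoc : ∀ f g h → (f ⋆ g) ⋆ h ≈ f ⋆ (g ⋆ h)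
⋆-assoc f g h n = begin
  sumTo n (λ k → sumTo k (λ j → f j * g (k ∸ j)) * h (n ∸ k))
    ≡⟨ sumTo-cong n (λ k → sym (sumTo-*ʳ k (h (n ∸ k)) (λ j → f j * g (k ∸ j)))) ⟩
  sumTo n (λ k → sumTo k (λ j → f j * g (k ∸ j) * h (n ∸ k)))
    ≡⟨ sumTo-triangle n (λ j k → f j * g (k ∸ j) * h (n ∸ k)) ⟩
  sumTo n (λ j → sumTo (n ∸ j) (λ i → f j * g (j ℕ.+ i ∸ j) * h (n ∸ (j ℕ.+ i))))
    ≡⟨ sumTo-cong n (λ j → trans (sumTo-cong (n ∸ j) (reindex j))
                                 (sumTo-*ˡ (n ∸ j) (f j) (λ i → g i * h (n ∸ j ∸ i)))) ⟩
  sumTo n (λ j → f j * sumTo (n ∸ j) (λ i → g i * h (n ∸ j ∸ i))) ∎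
  where
  open ≡-Reasoning
  reindex : ∀ j i → f j * g (j ℕ.+ i ∸ j) * h (n ∸ (j ℕ.+ i)) ≡ f j * (g i * h (n ∸ j ∸ i))
  reindex j i = trans (cong₂ (λ a b → f j * g a * h b) (ℕP.m+n∸m≡n j i) (sym (ℕP.∸-+-assoc n j i)))
                      (*-assoc (f j) (g i) (h (n ∸ j ∸ i)))

⋆-distribˡ : ∀ f g h → f ⋆ (g ⊕ h) ≈ (f ⋆ g) ⊕ (f ⋆ h)
⋆-distribˡ f g h n =
  trans (sumTo-cong n (λ k → *-distribˡ-+ (f k) (g (n ∸ k)) (h (n ∸ k)))) (sumTo-+ n _ _)

⋆-distribʳ : ∀ f g h → (f ⊕ g) ⋆ h ≈ (f ⋆ h) ⊕ (g ⋆ h)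
⋆-distribʳ f g h =
  ≈-trans (⋆-comm (f ⊕ g) h) (≈-trans (⋆-distribˡ h f g) (⊕-cong (⋆-comm h f) (⋆-comm h g)))

⋆-·ʳ : ∀ c f g → f ⋆ (c · g) ≈ c · (f ⋆ g)
⋆-·ʳ c f g n = trans (sumTo-cong n (λ k → solve 3 (λ a c b → a :* (c :* b) := c :* (a :* b)) refl
                                               (f k) c (g (n ∸ k))))
                     (sumTo-*ˡ n c _)

⋆-·ˡ : ∀ c f g → (c · f) ⋆ g ≈ c · (f ⋆ g)
⋆-·ˡ c f g = ≈-trans (⋆-comm (c · f) g) (≈-trans (⋆-·ʳ c g f) (·-cong c (⋆-comm g f)))

·-· : ∀ c d f → c · (d · f) ≈ (c * d) · f
·-· c d f n = sym (*-assoc c d (f n))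

oneS-⋆ : ∀ f → oneS ⋆ f ≈ f
oneS-⋆ f zero    = *-identityˡ (f 0)
oneS-⋆ f (suc n) = begin
  sumTo (suc n) (λ k → oneS k * f (suc n ∸ k))       ≡⟨ sumTo-suc n _ ⟩
  1ℚ * f (suc n) + sumTo n (λ k → 0ℚ * f (n ∸ k))
    ≡⟨ cong₂ _+_ (*-identityˡ (f (suc n)))
                 (trans (sumTo-cong n (λ k → *-zeroˡ (f (n ∸ k)))) (sumTo-zero n)) ⟩
  f (suc n) + 0ℚ                                     ≡⟨ +-identityʳ _ ⟩
  f (suc n)                                          ∎
  where open ≡-Reasoning

⋆-oneS : ∀ f → f ⋆ oneS ≈ f
⋆-oneS f = ≈-trans (⋆-comm f oneS) (oneS-⋆ f)

⋆-linear : ∀ N (c : ℕ → ℚ) (f : PS) (h : ℕ → PS) →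
  f ⋆ (λ n → sumTo N (λ k → c k * h k n)) ≈ (λ n → sumTo N (λ k → c k * (f ⋆ h k) n))
⋆-linear N c f h n = begin
  sumTo n (λ i → f i * sumTo N (λ k → c k * h k (n ∸ i)))
    ≡⟨ sumTo-cong n (λ i → trans (sym (sumTo-*ˡ N (f i) _)) (sumTo-cong N (λ k →
         solve 3 (λ a c b → a :* (c :* b) := c :* (a :* b)) refl (f i) (c k) (h k (n ∸ i))))) ⟩
  sumTo n (λ i → sumTo N (λ k → c k * (f i * h k (n ∸ i))))  ≡⟨ sumTo-swap n N _ ⟩
  sumTo N (λ k → sumTo n (λ i → c k * (f i * h k (n ∸ i))))  ≡⟨ sumTo-cong N (λ k → sumTo-*ˡ n (c k) _) ⟩
  sumTo N (λ k → c k * (f ⋆ h k) n)                          ∎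
  where open ≡-Reasoning

^S-cong : ∀ {f g} r → f ≈ g → f ^S r ≈ g ^S r
^S-cong zero    p = ≈-refl
^S-cong (suc r) p = ⋆-cong p (^S-cong r p)

oneS-^S : ∀ r → oneS ^S r ≈ oneS
oneS-^S zero    = ≈-refl
oneS-^S (suc r) = ≈-trans (oneS-⋆ _) (oneS-^S r)

⋆-interchange : ∀ a b c d → (a ⋆ b) ⋆ (c ⋆ d) ≈ (a ⋆ c) ⋆ (b ⋆ d)
⋆-interchange a b c d = begin
  (a ⋆ b) ⋆ (c ⋆ d)  ≈⟨ ⋆-assoc a b (c ⋆ d) ⟩
  a ⋆ (b ⋆ (c ⋆ d))  ≈⟨ ⋆-congʳ a (≈-sym (⋆-assoc b c d)) ⟩
  a ⋆ ((b ⋆ c) ⋆ d)  ≈⟨ ⋆-congʳ a (⋆-congˡ d (⋆-comm b c)) ⟩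
  a ⋆ ((c ⋆ b) ⋆ d)  ≈⟨ ⋆-congʳ a (⋆-assoc c b d) ⟩
  a ⋆ (c ⋆ (b ⋆ d))  ≈⟨ ≈-sym (⋆-assoc a c (b ⋆ d)) ⟩
  (a ⋆ c) ⋆ (b ⋆ d)  ∎
  where open ≈-Reasoning

^S-⋆ : ∀ f g r → (f ⋆ g) ^S r ≈ (f ^S r) ⋆ (g ^S r)
^S-⋆ f g zero    = ≈-sym (oneS-⋆ oneS)
^S-⋆ f g (suc r) = ≈-trans (⋆-congʳ (f ⋆ g) (^S-⋆ f g r)) (⋆-interchange f g (f ^S r) (g ^S r))

^S-· : ∀ c f r → (c · f) ^S r ≈ (c ^ℚ r) · (f ^S r)
^S-· c f zero    n = sym (*-identityˡ _)
^S-· c f (suc r) = begin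
  (c · f) ⋆ ((c · f) ^S r)             ≈⟨ ⋆-congʳ (c · f) (^S-· c f r) ⟩
  (c · f) ⋆ ((c ^ℚ r) · (f ^S r))      ≈⟨ ⋆-·ˡ c f ((c ^ℚ r) · (f ^S r)) ⟩
  c · (f ⋆ ((c ^ℚ r) · (f ^S r)))      ≈⟨ ·-cong c (⋆-·ʳ (c ^ℚ r) f (f ^S r)) ⟩
  c · ((c ^ℚ r) · (f ⋆ (f ^S r)))      ≈⟨ ·-· c (c ^ℚ r) _ ⟩
  (c * (c ^ℚ r)) · (f ⋆ (f ^S r))      ∎
  where open ≈-Reasoning

cancel-powers : ∀ {f g} → f ⋆ g ≈ oneS → ∀ r h → (f ^S r) ⋆ ((g ^S r) ⋆ h) ≈ h
cancel-powers {f} {g} fg r h = begin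
  (f ^S r) ⋆ ((g ^S r) ⋆ h)  ≈⟨ ≈-sym (⋆-assoc (f ^S r) (g ^S r) h) ⟩
  ((f ^S r) ⋆ (g ^S r)) ⋆ h  ≈⟨ ⋆-congˡ h (≈-sym (^S-⋆ f g r)) ⟩
  ((f ⋆ g) ^S r) ⋆ h         ≈⟨ ⋆-congˡ h (≈-trans (^S-cong r fg) (oneS-^S r)) ⟩
  oneS ⋆ h                   ≈⟨ oneS-⋆ h ⟩
  h                          ∎
  where open ≈-Reasoning

invRev-applyUpTo : ∀ f n → invRev f n ≡ applyUpTo (λ i → invS f (n ∸ i)) (suc n)
invRev-applyUpTo f zero    = refl
invRev-applyUpTo f (suc n) = cong (invS f (suc n) ∷_) (invRev-applyUpTo f n)

map-applyUpTo : ∀ (g : ℕ → ℚ) (h : ℕ → ℕ) m → map g (applyUpTo h m) ≡ applyUpTo (λ k → g (h k)) m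
map-applyUpTo g h zero    = refl
map-applyUpTo g h (suc m) = cong (g (h 0) ∷_) (map-applyUpTo g (λ k → h (suc k)) m)

zipWith-applyUpTo : ∀ (a b : ℕ → ℚ) m →
  zipWith _*_ (applyUpTo a m) (applyUpTo b m) ≡ applyUpTo (λ k → a k * b k) m
zipWith-applyUpTo a b zero    = refl
zipWith-applyUpTo a b (suc m) = cong (a 0 * b 0 ∷_) (zipWith-applyUpTo (λ k → a (suc k)) (λ k → b (suc k)) m)

foldr-applyUpTo : ∀ (c : ℕ → ℚ) n → foldr _+_ 0ℚ (applyUpTo c (suc n)) ≡ sumTo n c
foldr-applyUpTo c zero    = +-identityʳ (c 0)
foldr-applyUpTo c (suc n) =
  trans (cong (c 0 +_) (foldr-applyUpTo (λ k → c (suc k)) n)) (sym (sumTo-suc n c))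

invS-suc : ∀ f n → invS f (suc n) ≡ - sumTo n (λ k → f (suc k) * invS f (n ∸ k))
invS-suc f n = cong -_ (begin
  foldr _+_ 0ℚ (zipWith _*_ (map (λ k → f (suc k)) (upTo (suc n))) (invRev f n))
    ≡⟨ cong₂ (λ a b → foldr _+_ 0ℚ (zipWith _*_ a b))
             (map-applyUpTo (λ k → f (suc k)) (λ k → k) (suc n)) (invRev-applyUpTo f n) ⟩
  foldr _+_ 0ℚ (zipWith _*_ (applyUpTo (λ k → f (suc k)) (suc n)) (applyUpTo (λ i → invS f (n ∸ i)) (suc n)))
    ≡⟨ cong (foldr _+_ 0ℚ) (zipWith-applyUpTo (λ k → f (suc k)) (λ i → invS f (n ∸ i)) (suc n)) ⟩
  foldr _+_ 0ℚ (applyUpTo (λ k → f (suc k) * invS f (n ∸ k)) (suc n))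
    ≡⟨ foldr-applyUpTo _ n ⟩
  sumTo n (λ k → f (suc k) * invS f (n ∸ k)) ∎)
  where open ≡-Reasoning

invS-inverse : ∀ f → f 0 ≡ 1ℚ → f ⋆ invS f ≈ oneS
invS-inverse f f0 zero    = cong (_* 1ℚ) f0
invS-inverse f f0 (suc n) = begin
  sumTo (suc n) (λ k → f k * invS f (suc n ∸ k))  ≡⟨ sumTo-suc n _ ⟩
  f 0 * invS f (suc n) + S                        ≡⟨ cong₂ (λ a b → a * b + S) f0 (invS-suc f n) ⟩
  1ℚ * (- S) + S                                  ≡⟨ solve 1 (λ s → con 1ℚ :* (:- s) :+ s := con 0ℚ) refl S ⟩
  0ℚ                                              ∎
  where
  open ≡-Reasoning
  S = sumTo n (λ k → f (suc k) * invS f (n ∸ k))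

-- The Euler operator θ = t·d/dt and the shift T = multiplication by t

θ : PS → PS
θ f n = ℕ→ℚ n * f n

T : PS → PS
T f zero    = 0ℚ
T f (suc n) = f n

θ-cong : ∀ {f g} → f ≈ g → θ f ≈ θ g
θ-cong p n = cong (ℕ→ℚ n *_) (p n)

T-cong : ∀ {f g} → f ≈ g → T f ≈ T g
T-cong p zero    = refl
T-cong p (suc n) = p n

θ-⋆ : ∀ f g → θ (f ⋆ g) ≈ (θ f ⋆ g) ⊕ (f ⋆ θ g)
θ-⋆ f g n = begin
  ℕ→ℚ n * sumTo n (λ k → f k * g (n ∸ k))     ≡⟨ sym (sumTo-*ˡ n (ℕ→ℚ n) (λ k → f k * g (n ∸ k))) ⟩
  sumTo n (λ k → ℕ→ℚ n * (f k * g (n ∸ k)))   ≡⟨ sumTo-cong-≤ n split-degree ⟩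
  sumTo n (λ k → θ f k * g (n ∸ k) + f k * θ g (n ∸ k)) ≡⟨ sumTo-+ n _ _ ⟩
  (θ f ⋆ g) n + (f ⋆ θ g) n                   ∎
  where
  open ≡-Reasoning
  -- n = k + (n − k)
  split-degree : ∀ k → k ℕ.≤ n → ℕ→ℚ n * (f k * g (n ∸ k)) ≡ θ f k * g (n ∸ k) + f k * θ g (n ∸ k)
  split-degree k k≤n = begin
    ℕ→ℚ n * (f k * g (n ∸ k))                 ≡⟨ cong (λ z → ℕ→ℚ z * (f k * g (n ∸ k))) (sym (ℕP.m+[n∸m]≡n k≤n)) ⟩
    ℕ→ℚ (k ℕ.+ (n ∸ k)) * (f k * g (n ∸ k))   ≡⟨ cong (_* (f k * g (n ∸ k))) (ℕ→ℚ-+ k (n ∸ k)) ⟩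
    (ℕ→ℚ k + ℕ→ℚ (n ∸ k)) * (f k * g (n ∸ k))
      ≡⟨ solve 4 (λ a b x y → (a :+ b) :* (x :* y) := a :* x :* y :+ x :* (b :* y)) refl
                 (ℕ→ℚ k) (ℕ→ℚ (n ∸ k)) (f k) (g (n ∸ k)) ⟩
    θ f k * g (n ∸ k) + f k * θ g (n ∸ k)     ∎

T-⋆ : ∀ f g → T f ⋆ g ≈ T (f ⋆ g)
T-⋆ f g zero    = *-zeroˡ (g 0)
T-⋆ f g (suc n) =
  trans (sumTo-suc n _) (trans (cong (_+ (f ⋆ g) n) (*-zeroˡ (g (suc n)))) (+-identityˡ _))

-- The differential equation  θ u = c·T u  (i.e. u′ = c u) has at most one solution
-- with a given constant term.
θ-ode-unique : ∀ c {u v} → θ u ≈ c · T u → θ v ≈ c · T v → u 0 ≡ v 0 → u ≈ v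
θ-ode-unique c hu hv h0 zero    = h0
θ-ode-unique c hu hv h0 (suc n) =
  ℕ→ℚ-cancelˡ n (trans (hu (suc n)) (trans (cong (c *_) (θ-ode-unique c hu hv h0 n)) (sym (hv (suc n)))))

θ-exp : ∀ x → θ (expS x) ≈ x · T (expS x)
θ-exp x zero    = trans (*-zeroˡ (expS x 0)) (sym (*-zeroʳ x))
θ-exp x (suc n) = begin
  ℕ→ℚ (suc n) * (x * (x ^ℚ n) * recipℕ (suc n !))
    ≡⟨ solve 4 (λ a x p r → a :* (x :* p :* r) := x :* (p :* (a :* r))) refl
               (ℕ→ℚ (suc n)) x (x ^ℚ n) (recipℕ (suc n !)) ⟩
  x * ((x ^ℚ n) * (ℕ→ℚ (suc n) * recipℕ (suc n !)))  ≡⟨ cong (λ z → x * ((x ^ℚ n) * z)) (recipℕ-!-step n) ⟩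
  x * ((x ^ℚ n) * recipℕ (n !))                      ∎
  where open ≡-Reasoning

-- e^{xt} e^{yt} = e^{(x+y)t}: both sides solve u′ = (x+y) u with u(0) = 1.
exp-+ : ∀ x y → expS x ⋆ expS y ≈ expS (x + y)
exp-+ x y = θ-ode-unique (x + y) product-ode (θ-exp (x + y)) refl
  where
  eˣ = expS x
  eʸ = expS y
  product-ode : θ (eˣ ⋆ eʸ) ≈ (x + y) · T (eˣ ⋆ eʸ)
  product-ode n = begin
    θ (eˣ ⋆ eʸ) n                                    ≡⟨ θ-⋆ eˣ eʸ n ⟩
    (θ eˣ ⋆ eʸ) n + (eˣ ⋆ θ eʸ) n
      ≡⟨ cong₂ _+_ (⋆-congˡ eʸ (θ-exp x) n) (⋆-congʳ eˣ (θ-exp y) n) ⟩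
    ((x · T eˣ) ⋆ eʸ) n + (eˣ ⋆ (y · T eʸ)) n
      ≡⟨ cong₂ _+_ (⋆-·ˡ x (T eˣ) eʸ n) (⋆-·ʳ y eˣ (T eʸ) n) ⟩
    x * (T eˣ ⋆ eʸ) n + y * (eˣ ⋆ T eʸ) n
      ≡⟨ cong₂ (λ a b → x * a + y * b) (T-⋆ eˣ eʸ n)
               (trans (⋆-comm eˣ (T eʸ) n) (trans (T-⋆ eʸ eˣ n) (T-cong (⋆-comm eʸ eˣ) n))) ⟩
    x * T (eˣ ⋆ eʸ) n + y * T (eˣ ⋆ eʸ) n            ≡⟨ sym (*-distribʳ-+ _ x y) ⟩
    (x + y) * T (eˣ ⋆ eʸ) n                          ∎
    where open ≡-Reasoning

-- The left-hand side: binomial expansion of (1 + e^t)^N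

two·expp1Over2 : ℕ→ℚ 2 · expp1Over2 ≈ oneS ⊕ expS 1ℚ
two·expp1Over2 zero    = refl
two·expp1Over2 (suc k) = begin
  ℕ→ℚ 2 * recipℕ (2 ℕ.* (suc k !))  ≡⟨ cong (ℕ→ℚ 2 *_) (recipℕ-* 2 (suc k !)) ⟩
  ℕ→ℚ 2 * (recipℕ 2 * r)            ≡⟨ sym (*-assoc (ℕ→ℚ 2) (recipℕ 2) r) ⟩
  ℕ→ℚ 2 * recipℕ 2 * r              ≡⟨ cong (_* r) (trans (*-comm (ℕ→ℚ 2) (recipℕ 2)) (recipℕ-inverse 2)) ⟩
  1ℚ * r                            ≡⟨ solve 1 (λ r → con 1ℚ :* r := con 0ℚ :+ con 1ℚ :* r) refl r ⟩
  0ℚ + 1ℚ * r                       ≡⟨ cong (λ z → 0ℚ + z * r) (sym (1^ℚ (suc k))) ⟩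
  0ℚ + (1ℚ ^ℚ suc k) * r            ∎
  where
  open ≡-Reasoning
  r = recipℕ (suc k !)

binomialExp : ℕ → ℚ → PS
binomialExp N y n = sumTo N (λ k → ℕ→ℚ (N C k) * expS (y + ℕ→ℚ k) n)

pascal-sum : ∀ N (a : ℕ → ℚ) →
  sumTo N (λ k → ℕ→ℚ (N C k) * a k) + sumTo N (λ k → ℕ→ℚ (N C k) * a (suc k))
  ≡ sumTo (suc N) (λ k → ℕ→ℚ (suc N C k) * a k)
pascal-sum N a = begin
  sumTo N g + A              ≡⟨ cong (_+ A) drop-first ⟩
  (a 0 + B) + A              ≡⟨ solve 3 (λ x y z → (x :+ y) :+ z := x :+ (z :+ y)) refl (a 0) B A ⟩
  a 0 + (A + B)              ≡⟨ cong (a 0 +_) (sym (sumTo-+ N _ _)) ⟩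
  a 0 + sumTo N (λ k → ℕ→ℚ (N C k) * a (suc k) + ℕ→ℚ (N C suc k) * a (suc k))
    ≡⟨ cong₂ _+_ (sym (*-identityˡ (a 0))) (sumTo-cong N pascal-term) ⟩
  1ℚ * a 0 + sumTo N (λ k → ℕ→ℚ (suc N C suc k) * a (suc k))  ≡⟨ sym (sumTo-suc N _) ⟩
  sumTo (suc N) (λ k → ℕ→ℚ (suc N C k) * a k) ∎
  where
  open ≡-Reasoning
  g = λ k → ℕ→ℚ (N C k) * a k
  A = sumTo N (λ k → ℕ→ℚ (N C k) * a (suc k))
  B = sumTo N (λ k → ℕ→ℚ (N C suc k) * a (suc k))
  pascal-term : ∀ k → ℕ→ℚ (N C k) * a (suc k) + ℕ→ℚ (N C suc k) * a (suc k) ≡ ℕ→ℚ (suc N C suc k) * a (suc k)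
  pascal-term k = trans (sym (*-distribʳ-+ (a (suc k)) (ℕ→ℚ (N C k)) (ℕ→ℚ (N C suc k))))
    (cong (_* a (suc k)) (trans (sym (ℕ→ℚ-+ (N C k) (N C suc k))) (cong ℕ→ℚ (nCk+nC[k+1]≡[n+1]C[k+1] N k))))
  -- adding the vanishing term C(N, N+1) a_{N+1} and splitting off k = 0
  drop-first : sumTo N g ≡ a 0 + B
  drop-first = begin
    sumTo N g              ≡⟨ sym (+-identityʳ _) ⟩
    sumTo N g + 0ℚ
      ≡⟨ cong (sumTo N g +_) (sym (trans (cong (λ z → ℕ→ℚ z * a (suc N)) (k>n⇒nCk≡0 (ℕP.n<1+n N)))
                                         (*-zeroˡ (a (suc N))))) ⟩
    sumTo (suc N) g        ≡⟨ sumTo-suc N g ⟩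
    1ℚ * a 0 + B           ≡⟨ cong (_+ B) (*-identityˡ (a 0)) ⟩
    a 0 + B                ∎

binomial-exp : ∀ N y → ((oneS ⊕ expS 1ℚ) ^S N) ⋆ expS y ≈ binomialExp N y
binomial-exp zero    y n = trans (oneS-⋆ (expS y) n)
  (trans (cong (λ z → expS z n) (sym (+-identityʳ y))) (sym (*-identityˡ _)))
binomial-exp (suc N) y = begin
  (Q ⋆ (Q ^S N)) ⋆ expS y                  ≈⟨ ⋆-assoc Q (Q ^S N) (expS y) ⟩
  Q ⋆ ((Q ^S N) ⋆ expS y)                  ≈⟨ ⋆-congʳ Q (binomial-exp N y) ⟩
  Q ⋆ binomialExp N y                      ≈⟨ ⋆-distribʳ oneS (expS 1ℚ) (binomialExp N y) ⟩
  (oneS ⋆ binomialExp N y) ⊕ (expS 1ℚ ⋆ binomialExp N y)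
    ≈⟨ ⊕-cong (oneS-⋆ (binomialExp N y)) (⋆-linear N (λ k → ℕ→ℚ (N C k)) (expS 1ℚ) (λ k → expS (y + ℕ→ℚ k))) ⟩
  binomialExp N y ⊕ (λ n → sumTo N (λ k → ℕ→ℚ (N C k) * (expS 1ℚ ⋆ expS (y + ℕ→ℚ k)) n))
    ≈⟨ ⊕-cong (≈-refl {binomialExp N y}) (λ n → sumTo-cong N (λ k → cong (ℕ→ℚ (N C k) *_) (shift-exponent k n))) ⟩
  binomialExp N y ⊕ (λ n → sumTo N (λ k → ℕ→ℚ (N C k) * expS (y + ℕ→ℚ (suc k)) n))
    ≈⟨ (λ n → pascal-sum N (λ k → expS (y + ℕ→ℚ k) n)) ⟩
  binomialExp (suc N) y                    ∎
  where
  open ≈-Reasoning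
  Q = oneS ⊕ expS 1ℚ
  shift-exponent : ∀ k → expS 1ℚ ⋆ expS (y + ℕ→ℚ k) ≈ expS (y + ℕ→ℚ (suc k))
  shift-exponent k n = trans (exp-+ 1ℚ (y + ℕ→ℚ k) n) (cong (λ z → expS z n)
    (trans (solve 2 (λ y a → con 1ℚ :+ (y :+ a) := y :+ (con 1ℚ :+ a)) refl y (ℕ→ℚ k))
           (cong (y +_) (sym (ℕ→ℚ-+ 1 k)))))

eulerFactor : ℕ → PS
eulerFactor N = invS expp1Over2 ^S N

-- G^N (1 + e^t)^N e^{xt} = G^N (2P)^N e^{xt} = 2^N e^{xt}
eulerFactor-binomialExp : ∀ N x → eulerFactor N ⋆ binomialExp N x ≈ (ℕ→ℚ 2 ^ℚ N) · expS x
eulerFactor-binomialExp N x = begin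
  Gᴺ ⋆ binomialExp N x                      ≈⟨ ⋆-congʳ Gᴺ (≈-sym (binomial-exp N x)) ⟩
  Gᴺ ⋆ (((oneS ⊕ expS 1ℚ) ^S N) ⋆ expS x)
    ≈⟨ ⋆-congʳ Gᴺ (⋆-congˡ (expS x) (≈-trans (^S-cong N (≈-sym two·expp1Over2)) (^S-· (ℕ→ℚ 2) P N))) ⟩
  Gᴺ ⋆ ((c · (P ^S N)) ⋆ expS x)            ≈⟨ ⋆-congʳ Gᴺ (⋆-·ˡ c (P ^S N) (expS x)) ⟩
  Gᴺ ⋆ (c · ((P ^S N) ⋆ expS x))            ≈⟨ ⋆-·ʳ c Gᴺ ((P ^S N) ⋆ expS x) ⟩
  c · (Gᴺ ⋆ ((P ^S N) ⋆ expS x))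
    ≈⟨ ·-cong c (cancel-powers (≈-trans (⋆-comm G P) (invS-inverse P refl)) N (expS x)) ⟩
  c · expS x                                ∎
  where
  open ≈-Reasoning
  P = expp1Over2
  G = invS P
  Gᴺ = eulerFactor N
  c = ℕ→ℚ 2 ^ℚ N

euler-binomial-sum : ∀ N m x →
  sumTo N (λ k → ℕ→ℚ (N C k) * Epoly N m (x + ℕ→ℚ k)) ≡ ℕ→ℚ (m !) * ((ℕ→ℚ 2 ^ℚ N) * expS x m)
euler-binomial-sum N m x = begin
  sumTo N (λ k → ℕ→ℚ (N C k) * (m! * (Gᴺ ⋆ expS (x + ℕ→ℚ k)) m))
    ≡⟨ sumTo-cong N (λ k → solve 3 (λ a b c → a :* (b :* c) := b :* (a :* c)) refl (ℕ→ℚ (N C k)) m! _) ⟩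
  sumTo N (λ k → m! * (ℕ→ℚ (N C k) * (Gᴺ ⋆ expS (x + ℕ→ℚ k)) m))
    ≡⟨ sumTo-*ˡ N m! _ ⟩
  m! * sumTo N (λ k → ℕ→ℚ (N C k) * (Gᴺ ⋆ expS (x + ℕ→ℚ k)) m)
    ≡⟨ cong (m! *_) (sym (⋆-linear N (λ k → ℕ→ℚ (N C k)) Gᴺ (λ k → expS (x + ℕ→ℚ k)) m)) ⟩
  m! * (Gᴺ ⋆ binomialExp N x) m             ≡⟨ cong (m! *_) (eulerFactor-binomialExp N x m) ⟩
  m! * ((ℕ→ℚ 2 ^ℚ N) * expS x m)            ∎
  where
  open ≡-Reasoning
  m! = ℕ→ℚ (m !)
  Gᴺ = eulerFactor N

-- The right-hand side: the generating function of S₂(·, A)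

S₂-above-diagonal : ∀ n j → S₂ n (suc (j ℕ.+ n)) ≡ 0
S₂-above-diagonal zero    j = refl
S₂-above-diagonal (suc n) j
  rewrite ℕP.+-suc j n | S₂-above-diagonal n (suc j) | S₂-above-diagonal n j =
  trans (ℕP.+-identityʳ _) (ℕP.*-zeroʳ (j ℕ.+ n))

S₂-diagonal : ∀ n → S₂ n n ≡ 1
S₂-diagonal zero    = refl
S₂-diagonal (suc n) rewrite S₂-above-diagonal n 0 | S₂-diagonal n = cong (ℕ._+ 1) (ℕP.*-zeroʳ n)

F : PS
F = expm1OverT

stirlingSeries : ℕ → PS
stirlingSeries A l = ℕ→ℚ (A !) * ℕ→ℚ (S₂ (l ℕ.+ A) A) * recipℕ ((l ℕ.+ A) !)

stirlingSeries-0 : ∀ A → stirlingSeries A 0 ≡ 1ℚ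
stirlingSeries-0 A = begin
  ℕ→ℚ (A !) * ℕ→ℚ (S₂ A A) * recipℕ (A !)  ≡⟨ cong (λ z → ℕ→ℚ (A !) * ℕ→ℚ z * recipℕ (A !)) (S₂-diagonal A) ⟩
  ℕ→ℚ (A !) * 1ℚ * recipℕ (A !)
    ≡⟨ solve 2 (λ a r → a :* con 1ℚ :* r := r :* a) refl (ℕ→ℚ (A !)) (recipℕ (A !)) ⟩
  recipℕ (A !) * ℕ→ℚ (A !)                ≡⟨ recipℕ-!-inverse A ⟩
  1ℚ                                      ∎
  where open ≡-Reasoning

stirling-recurrence-unique : ∀ A (w : PS) {u v} →
  (∀ l → ℕ→ℚ (l ℕ.+ suc A) * u l ≡ ℕ→ℚ (suc A) * (T u l + w l)) →
  (∀ l → ℕ→ℚ (l ℕ.+ suc A) * v l ≡ ℕ→ℚ (suc A) * (T v l + w l)) → u ≈ v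
stirling-recurrence-unique A w hu hv zero = ℕ→ℚ-cancelˡ A (trans (hu 0) (sym (hv 0)))
stirling-recurrence-unique A w {u} {v} hu hv (suc l) = ℕ→ℚ-cancelˡ (suc l ℕ.+ A) (begin
  ℕ→ℚ (suc (suc l ℕ.+ A)) * u (suc l)   ≡⟨ cong (λ z → ℕ→ℚ z * u (suc l)) (sym l+1+A) ⟩
  ℕ→ℚ (suc l ℕ.+ suc A) * u (suc l)     ≡⟨ hu (suc l) ⟩
  ℕ→ℚ (suc A) * (u l + w (suc l))
    ≡⟨ cong (λ z → ℕ→ℚ (suc A) * (z + w (suc l))) (stirling-recurrence-unique A w hu hv l) ⟩
  ℕ→ℚ (suc A) * (v l + w (suc l))       ≡⟨ sym (hv (suc l)) ⟩
  ℕ→ℚ (suc l ℕ.+ suc A) * v (suc l)     ≡⟨ cong (λ z → ℕ→ℚ z * v (suc l)) l+1+A ⟩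
  ℕ→ℚ (suc (suc l ℕ.+ A)) * v (suc l)   ∎)
  where
  open ≡-Reasoning
  l+1+A = ℕP.+-suc (suc l) A

-- The Stirling recurrence S₂(M+1, A+1) = (A+1) S₂(M, A+1) + S₂(M, A), rescaled by (A+1)!/M!.
stirling-step : ∀ A M →
  ℕ→ℚ (suc M) * (ℕ→ℚ (suc A !) * ℕ→ℚ (S₂ (suc M) (suc A)) * recipℕ (suc M !))
  ≡ ℕ→ℚ (suc A) * (ℕ→ℚ (suc A !) * ℕ→ℚ (S₂ M (suc A)) * recipℕ (M !)
                   + ℕ→ℚ (A !) * ℕ→ℚ (S₂ M A) * recipℕ (M !))
stirling-step A M = begin
  ℕ→ℚ (suc M) * (ℕ→ℚ (suc A ℕ.* A !) * ℕ→ℚ (suc A ℕ.* S₂ M (suc A) ℕ.+ S₂ M A) * recipℕ (suc M !))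
    ≡⟨ cong₂ (λ p q → ℕ→ℚ (suc M) * (p * q * recipℕ (suc M !))) (ℕ→ℚ-* (suc A) (A !))
         (trans (ℕ→ℚ-+ (suc A ℕ.* S₂ M (suc A)) (S₂ M A)) (cong (_+ Y) (ℕ→ℚ-* (suc A) (S₂ M (suc A))))) ⟩
  ℕ→ℚ (suc M) * (b * a * (b * X + Y) * recipℕ (suc M !))
    ≡⟨ solve 6 (λ s b a X Y r → s :* (b :* a :* (b :* X :+ Y) :* r) := b :* a :* (b :* X :+ Y) :* (s :* r)) refl
               (ℕ→ℚ (suc M)) b a X Y (recipℕ (suc M !)) ⟩
  b * a * (b * X + Y) * (ℕ→ℚ (suc M) * recipℕ (suc M !))
    ≡⟨ cong (λ z → b * a * (b * X + Y) * z) (recipℕ-!-step M) ⟩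
  b * a * (b * X + Y) * r
    ≡⟨ solve 5 (λ b a X Y r → b :* a :* (b :* X :+ Y) :* r := b :* (b :* a :* X :* r :+ a :* Y :* r)) refl b a X Y r ⟩
  b * (b * a * X * r + a * Y * r)
    ≡⟨ cong (λ z → b * (z * X * r + a * Y * r)) (sym (ℕ→ℚ-* (suc A) (A !))) ⟩
  b * (ℕ→ℚ (suc A !) * X * r + a * Y * r) ∎
  where
  open ≡-Reasoning
  b = ℕ→ℚ (suc A)
  a = ℕ→ℚ (A !)
  X = ℕ→ℚ (S₂ M (suc A))
  Y = ℕ→ℚ (S₂ M A)
  r = recipℕ (M !)

stirlingSeries-recurrence : ∀ A l →
  ℕ→ℚ (l ℕ.+ suc A) * stirlingSeries (suc A) l
  ≡ ℕ→ℚ (suc A) * (T (stirlingSeries (suc A)) l + stirlingSeries A l)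
stirlingSeries-recurrence A zero = cong (ℕ→ℚ (suc A) *_)
  (trans (stirlingSeries-0 (suc A)) (sym (trans (+-identityˡ (stirlingSeries A 0)) (stirlingSeries-0 A))))
stirlingSeries-recurrence A (suc l) =
  trans (stirling-step A (l ℕ.+ suc A))
        (cong (λ M → ℕ→ℚ (suc A) * (stirlingSeries (suc A) l + ℕ→ℚ (A !) * ℕ→ℚ (S₂ M A) * recipℕ (M !)))
              (ℕP.+-suc l A))

-- θ F + F = e^t, i.e. (t F)′ = e^t.
θF⊕F : θ F ⊕ F ≈ expS 1ℚ
θF⊕F n = begin
  ℕ→ℚ n * r + r          ≡⟨ solve 2 (λ a r → a :* r :+ r := (con 1ℚ :+ a) :* r) refl (ℕ→ℚ n) r ⟩
  (1ℚ + ℕ→ℚ n) * r       ≡⟨ cong (_* r) (sym (ℕ→ℚ-+ 1 n)) ⟩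
  ℕ→ℚ (suc n) * r        ≡⟨ recipℕ-!-step n ⟩
  recipℕ (n !)           ≡⟨ sym (*-identityˡ _) ⟩
  1ℚ * recipℕ (n !)      ≡⟨ cong (_* recipℕ (n !)) (sym (1^ℚ n)) ⟩
  (1ℚ ^ℚ n) * recipℕ (n !) ∎
  where
  open ≡-Reasoning
  r = recipℕ (suc n !)

exp1-split : expS 1ℚ ≈ oneS ⊕ T F
exp1-split zero    = refl
exp1-split (suc n) = trans (cong (_* recipℕ (suc n !)) (1^ℚ (suc n)))
  (trans (*-identityˡ (recipℕ (suc n !))) (sym (+-identityˡ (recipℕ (suc n !)))))

θ-^S : ∀ f A → θ (f ^S suc A) ≈ ℕ→ℚ (suc A) · ((f ^S A) ⋆ θ f)
θ-^S f zero = begin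
  θ (f ⋆ oneS)           ≈⟨ θ-cong (⋆-oneS f) ⟩
  θ f                    ≈⟨ ≈-sym (oneS-⋆ (θ f)) ⟩
  oneS ⋆ θ f             ≈⟨ (λ n → sym (*-identityˡ _)) ⟩
  ℕ→ℚ 1 · (oneS ⋆ θ f)   ∎
  where open ≈-Reasoning
θ-^S f (suc A) = begin
  θ (f ⋆ (f ^S suc A))                           ≈⟨ θ-⋆ f (f ^S suc A) ⟩
  (θ f ⋆ (f ^S suc A)) ⊕ (f ⋆ θ (f ^S suc A))
    ≈⟨ ⊕-cong (⋆-comm (θ f) (f ^S suc A)) (⋆-congʳ f (θ-^S f A)) ⟩
  X ⊕ (f ⋆ (b · ((f ^S A) ⋆ θ f)))               ≈⟨ ⊕-cong (≈-refl {X}) (⋆-·ʳ b f ((f ^S A) ⋆ θ f)) ⟩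
  X ⊕ (b · (f ⋆ ((f ^S A) ⋆ θ f)))               ≈⟨ ⊕-cong (≈-refl {X}) (·-cong b (≈-sym (⋆-assoc f (f ^S A) (θ f)))) ⟩
  X ⊕ (b · X)                                    ≈⟨ collect ⟩
  ℕ→ℚ (suc (suc A)) · X                          ∎
  where
  open ≈-Reasoning
  b = ℕ→ℚ (suc A)
  X = (f ^S suc A) ⋆ θ f
  collect : X ⊕ (b · X) ≈ ℕ→ℚ (suc (suc A)) · X
  collect n = trans (solve 2 (λ x b → x :+ b :* x := (con 1ℚ :+ b) :* x) refl (X n) b)
                    (cong (_* X n) (sym (ℕ→ℚ-+ 1 (suc A))))

-- The powers of F satisfy the same recurrence as the Stirling series.
F^S-recurrence : ∀ A l →
  ℕ→ℚ (l ℕ.+ suc A) * (F ^S suc A) l ≡ ℕ→ℚ (suc A) * (T (F ^S suc A) l + (F ^S A) l)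
F^S-recurrence A l = begin
  ℕ→ℚ (l ℕ.+ suc A) * Fˢ l                          ≡⟨ cong (_* Fˢ l) (ℕ→ℚ-+ l (suc A)) ⟩
  (ℕ→ℚ l + b) * Fˢ l                                 ≡⟨ *-distribʳ-+ (Fˢ l) (ℕ→ℚ l) b ⟩
  θ Fˢ l + b * Fˢ l                                  ≡⟨ cong₂ _+_ (θ-^S F A l) (cong (b *_) (⋆-comm F Fᴬ l)) ⟩
  b * (Fᴬ ⋆ θ F) l + b * (Fᴬ ⋆ F) l                  ≡⟨ sym (*-distribˡ-+ b _ _) ⟩
  b * ((Fᴬ ⋆ θ F) l + (Fᴬ ⋆ F) l)                    ≡⟨ cong (b *_) (sym (⋆-distribˡ Fᴬ (θ F) F l)) ⟩
  b * (Fᴬ ⋆ (θ F ⊕ F)) l                             ≡⟨ cong (b *_) (⋆-congʳ Fᴬ (≈-trans θF⊕F exp1-split) l) ⟩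
  b * (Fᴬ ⋆ (oneS ⊕ T F)) l                          ≡⟨ cong (b *_) (⋆-distribˡ Fᴬ oneS (T F) l) ⟩
  b * ((Fᴬ ⋆ oneS) l + (Fᴬ ⋆ T F) l)
    ≡⟨ cong (b *_) (cong₂ _+_ (⋆-oneS Fᴬ l) (trans (⋆-comm Fᴬ (T F) l) (T-⋆ F Fᴬ l))) ⟩
  b * (Fᴬ l + T Fˢ l)                                ≡⟨ cong (b *_) (+-comm (Fᴬ l) (T Fˢ l)) ⟩
  b * (T Fˢ l + Fᴬ l)                                ∎
  where
  open ≡-Reasoning
  b = ℕ→ℚ (suc A)
  Fᴬ = F ^S A
  Fˢ = F ^S suc A

stirling-egf : ∀ A → stirlingSeries A ≈ F ^S A
stirling-egf zero zero    = refl
stirling-egf zero (suc l) rewrite ℕP.+-identityʳ l = *-zeroˡ (recipℕ (suc l !))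
stirling-egf (suc A) = stirling-recurrence-unique A (F ^S A)
  (λ l → trans (stirlingSeries-recurrence A l)
               (cong (λ z → ℕ→ℚ (suc A) * (T (stirlingSeries (suc A)) l + z)) (stirling-egf A l)))
  (F^S-recurrence A)

stirling-bernoulli-sum : ∀ m A x →
  sumTo m (λ l → (ℕ→ℚ (A !) * recipℕ (((l ℕ.+ A) !) ℕ.* ((m ∸ l) !)))
                 * ℕ→ℚ (S₂ (l ℕ.+ A) A) * Bpoly A (m ∸ l) x)
  ≡ expS x m
stirling-bernoulli-sum m A x = trans (sumTo-cong m term) (series m)
  where
  H = invS F
  series : stirlingSeries A ⋆ ((H ^S A) ⋆ expS x) ≈ expS x
  series = ≈-trans (⋆-congˡ ((H ^S A) ⋆ expS x) (stirling-egf A)) (cancel-powers (invS-inverse F refl) A (expS x))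
  -- the factor (m−l)! cancels against the one in B_{m−l}^{(A)}
  term : ∀ l → (ℕ→ℚ (A !) * recipℕ (((l ℕ.+ A) !) ℕ.* ((m ∸ l) !))) * ℕ→ℚ (S₂ (l ℕ.+ A) A) * Bpoly A (m ∸ l) x
               ≡ stirlingSeries A l * ((H ^S A) ⋆ expS x) (m ∸ l)
  term l = begin
    (a * recipℕ (((l ℕ.+ A) !) ℕ.* ((m ∸ l) !))) * s * (nQ * z)
      ≡⟨ cong (λ w → (a * w) * s * (nQ * z)) (recipℕ-* ((l ℕ.+ A) !) ((m ∸ l) !)) ⟩
    (a * (rP * rQ)) * s * (nQ * z)
      ≡⟨ solve 6 (λ a rP rQ s nQ z → (a :* (rP :* rQ)) :* s :* (nQ :* z) := (a :* s :* rP :* z) :* (rQ :* nQ)) refl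
                 a rP rQ s nQ z ⟩
    (a * s * rP * z) * (rQ * nQ)  ≡⟨ cong ((a * s * rP * z) *_) (recipℕ-!-inverse (m ∸ l)) ⟩
    (a * s * rP * z) * 1ℚ         ≡⟨ *-identityʳ _ ⟩
    a * s * rP * z                ∎
    where
    open ≡-Reasoning
    a = ℕ→ℚ (A !)
    s = ℕ→ℚ (S₂ (l ℕ.+ A) A)
    rP = recipℕ ((l ℕ.+ A) !)
    rQ = recipℕ ((m ∸ l) !)
    nQ = ℕ→ℚ ((m ∸ l) !)
    z = ((H ^S A) ⋆ expS x) (m ∸ l)

theorem7 : (m a b : ℕ) (x : ℚ) →
    sumTo (b ℕ.* suc m)
      (λ k → ℕ→ℚ ((b ℕ.* suc m) C k) * Epoly (b ℕ.* suc m) m (x + ℕ→ℚ k))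
    ≡ ℕ→ℚ (2 ℕ.^ (b ℕ.* suc m)) * ℕ→ℚ (m !) *
      sumTo m (λ l →
        (ℕ→ℚ ((a ℕ.* suc m) !)
          * recipℕ (((l ℕ.+ a ℕ.* suc m) !) ℕ.* ((m ℕ.∸ l) !)))
        * ℕ→ℚ (S₂ (l ℕ.+ a ℕ.* suc m) (a ℕ.* suc m))
        * Bpoly (a ℕ.* suc m) (m ℕ.∸ l) x)
theorem7 m a b x = begin
  _                                        ≡⟨ euler-binomial-sum N m x ⟩
  ℕ→ℚ (m !) * ((ℕ→ℚ 2 ^ℚ N) * expS x m)
    ≡⟨ solve 3 (λ f p e → f :* (p :* e) := p :* f :* e) refl (ℕ→ℚ (m !)) (ℕ→ℚ 2 ^ℚ N) (expS x m) ⟩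
  (ℕ→ℚ 2 ^ℚ N) * ℕ→ℚ (m !) * expS x m
    ≡⟨ cong₂ (λ p e → p * ℕ→ℚ (m !) * e) (sym (ℕ→ℚ-^ 2 N)) (sym (stirling-bernoulli-sum m (a ℕ.* suc m) x)) ⟩
  _                                        ∎
  where
  open ≡-Reasoning
  N = b ℕ.* suc m
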